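{- Let $n$ be an even positive integer. If $G$ is a connected graph on $n$ vertices with $|E(G)|\geqslant\binom{n-1}{2}+2$, then $G$ is $1$-extendable, unless $G$ is isomorphic to $K_2\vee(K_{n-3}\cup K_1)$ or to $K_3\vee 3K_1$.
   Context: All graphs are finite, simple and undirected. A graph with at least $4$ vertices that has a perfect matching is called $1$-extendable if every edge is contained in some perfect matching. $K_r$ is the complete graph on $r$ vertices; $tK_1$ is the edgeless graph on $t$ vertices; $G_1\cup G_2$ is the disjoint union; the join $G_1\vee G_2$ is obtained from $G_1\cup G_2$ by adding all edges between $V(G_1)$ and $V(G_2)$. -}

module Defs where

open import Data.Nat using (ℕ; zero; suc; _+_; _*_; _∸_; _<_; _≤_; _<ᵇ_)
open import Data.Nat.Combinatorics using (_C_)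
open import Data.Fin using (Fin; toℕ; _≟_)
open import Data.Bool using (Bool; true; false; _∧_; not; if_then_else_)
open import Data.List using (List; map; allFin)
open import Data.Nat.ListAction using (sum)
open import Data.Product using (Σ; _×_; _,_; ∃)
open import Function.Bundles using (_↔_; Inverse)
open import Relation.Nullary using (¬_)
open import Data.Empty using (⊥-elim)
open import Relation.Nullary.Decidable using (⌊_⌋)
open import Relation.Binary.PropositionalEquality using (_≡_; refl; sym; cong; cong₂)
open import Data.Bool.Properties using (∧-comm)
open import Relation.Nullary using (yes; no)

record Graph (n : ℕ) : Set where
  field
    adj   : Fin n → Fin n → Bool
    adj-sym : ∀ i j → adj i j ≡ adj j i
    irrefl : ∀ i → adj i i ≡ false
open Graph public

edgeCount : ∀ {n} → Graph n → ℕ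
edgeCount {n} G =
  sum (map (λ i → sum (map (λ j →
         if (toℕ i <ᵇ toℕ j) ∧ adj G i j then 1 else 0) (allFin n))) (allFin n))

data Walk {n} (G : Graph n) : Fin n → Fin n → Set where
  here : ∀ {u} → Walk G u u
  step : ∀ {u w v} → adj G u w ≡ true → Walk G w v → Walk G u v

Connected : ∀ {n} → Graph n → Set
Connected {n} G = ∀ (u v : Fin n) → Walk G u v

-- A perfect matching: every vertex i is matched with mate i along an edge,
-- and the matching relation is symmetric.  (Irreflexivity of adj rules out
-- mate i ≡ i.)  The matching's edge set is { {i , mate i} }.
record PerfectMatching {n} (G : Graph n) : Set where
  field
    mate     : Fin n → Fin n
    mate-adj : ∀ i → adj G i (mate i) ≡ true
    mate-inv : ∀ i → mate (mate i) ≡ i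
open PerfectMatching public

OneExtendable : ∀ {n} → Graph n → Set
OneExtendable {n} G =
  (4 ≤ n) × PerfectMatching G ×
  (∀ u v → adj G u v ≡ true → Σ (PerfectMatching G) λ M → mate M u ≡ v)

Isomorphic : ∀ {n m} → Graph n → Graph m → Set
Isomorphic {n} {m} G H =
  Σ (Fin n ↔ Fin m) λ f → ∀ i j → adj H (Inverse.to f i) (Inverse.to f j) ≡ adj G i j

neq : ∀ {k} → Fin k → Fin k → Bool
neq i j = not ⌊ i ≟ j ⌋

neq-sym : ∀ {k} (i j : Fin k) → neq i j ≡ neq j i
neq-sym i j with i ≟ j | j ≟ i
... | yes _ | yes _ = refl
... | no _  | no _  = refl
... | yes p | no q  = ⊥-elim (q (sym p))
... | no p  | yes q = ⊥-elim (p (sym q))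

neq-irrefl : ∀ {k} (i : Fin k) → neq i i ≡ false
neq-irrefl i with i ≟ i
... | yes _ = refl
... | no p  = ⊥-elim (p refl)

mkGraph : ∀ {k} → (Fin k → Fin k → Bool) → Graph k
mkGraph r = record
  { adj     = λ i j → neq i j ∧ (r i j ∧ r j i)
  ; adj-sym = λ i j → cong₂ _∧_ (neq-sym i j) (∧-comm (r i j) (r j i))
  ; irrefl  = λ i → cong (_∧ (r i i ∧ r i i)) (neq-irrefl i)
  }

-- K₂ ∨ (K_m ∪ K₁) on Fin (3 + m):
-- vertex 0 is the K₁, vertices 1,2 form the K₂, vertices 3,…,m+2 form K_m.
-- Distinct vertices are adjacent unless one is 0 and the other is ≥ 3.
K2∨[Km∪K1] : (m : ℕ) → Graph (3 + m)
K2∨[Km∪K1] m = mkGraph λ i j → not ((toℕ i <ᵇ 1) ∧ (2 <ᵇ toℕ j))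

-- K₃ ∨ 3K₁ on Fin 6: vertices 0,1,2 form the K₃, vertices 3,4,5 are
-- independent; distinct vertices are adjacent unless both are ≥ 3.
K3∨3K1 : Graph 6
K3∨3K1 = mkGraph λ i j → not ((2 <ᵇ toℕ i) ∧ (2 <ᵇ toℕ j))

module Submission where

-- Delete the ends of an edge uv of G. As G misses at most n − 3 edges, the remaining N = n − 2
-- vertices span at most N − 1 non-edges. A graph on an even number N of vertices with at most
-- N − 2 non-edges has a perfect matching: unless there are at most N − 4 non-edges, delete a
-- vertex with two non-neighbours together with a neighbour of it, or one endpoint of each of two
-- disjoint non-edges, and induct. With exactly N − 1 non-edges the same works unless some vertex
-- misses all the others, or N = 4 and three vertices are pairwise non-adjacent. In both cases the
-- non-edges of G − u − v use up the whole budget of G, so u and v see everything and every other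
-- pair is an edge, which is K₂ ∨ (K_{n−3} ∪ K₁), resp. K₃ ∨ 3K₁.

open import Defs
open import Data.Bool using (Bool; true; false; not; _∧_; if_then_else_)
open import Data.Bool.Properties using (∧-comm)
open import Data.Empty using (⊥-elim)
open import Data.Fin using (Fin; zero; suc; toℕ; _≟_)
open import Data.Fin.Permutation using (Permutation′; _⟨$⟩ʳ_; _⟨$⟩ˡ_; inverseˡ; id; transpose; _∘ₚ_)
import Data.Fin.Permutation.Components as PC
open import Data.List using (List; []; _∷_; _++_; length; map; allFin; tabulate)
open import Data.List.Properties using (length-tabulate)
open import Data.List.Membership.Propositional using (_∈_; find)
open import Data.List.Membership.Propositional.Properties using (∈-∃++; ∈-allFin)
open import Data.List.Relation.Binary.Permutation.Propositional as ↭
  using (_↭_; prep; swap; ↭-sym; ↭-refl; ↭-trans; ↭⇒↭ₛ)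
open import Data.List.Relation.Binary.Permutation.Propositional.Properties
  using (∈-resp-↭; ↭-length; shift; shifts; All-resp-↭)
open import Data.List.Relation.Unary.All as All using (All; []; _∷_)
open import Data.List.Relation.Unary.All.Properties using (¬Any⇒All¬)
open import Data.List.Relation.Unary.AllPairs as AllPairs using (AllPairs; []; _∷_)
open import Data.List.Relation.Unary.Any using (Any; here; there; any?)
open import Data.List.Relation.Unary.Unique.Propositional using (Unique)
open import Data.List.Relation.Unary.Unique.Propositional.Properties using (allFin⁺)
open import Data.Nat using (ℕ; zero; suc; _+_; _*_; _∸_; _<_; _≤_; _≥_; z≤n; s≤s; _<ᵇ_)
open import Data.Nat.Combinatorics using (_C_; nC1≡n; nCk+nC[k+1]≡[n+1]C[k+1])
open import Data.Nat.ListAction using (sum)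
open import Data.Nat.Properties hiding (_≟_)
open import Algebra.Properties.CommutativeSemigroup +-commutativeSemigroup
  using (x∙yz≈y∙xz; interchange)
open import Algebra.Properties.Monoid.Sum +-0-monoid using (sum-cong-≗) renaming (sum to ∑)
open import Data.Nat.Tactic.RingSolver using (solve-∀)
open import Data.Product as Product using (Σ; ∃; ∃₂; _×_; _,_; proj₁; proj₂)
open import Data.Sum as Sum using (_⊎_; inj₁; inj₂; [_,_])
open import Function using (_∘_)
open import Relation.Nullary using (¬_; yes; no; contradiction)
open import Relation.Binary.PropositionalEquality
  using (_≡_; _≢_; refl; setoid; sym; trans; cong; cong₂; subst; subst₂; module ≡-Reasoning)

module _ {A : Set} where

  Unique-↭ : ∀ {xs ys : List A} → xs ↭ ys → Unique xs → Unique ys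
  Unique-↭ p = Unique-resp-↭ (↭⇒↭ₛ p)
    where open import Data.List.Relation.Binary.Permutation.Setoid.Properties (setoid A) using (Unique-resp-↭)

  ∈⇒↭∷ : ∀ {x : A} {xs} → x ∈ xs → ∃ λ ys → xs ↭ x ∷ ys
  ∈⇒↭∷ x∈xs with ys , zs , refl ← ∈-∃++ x∈xs = ys ++ zs , shift _ ys zs

  pick : ∀ {P : A → Set} {xs} → Any P xs → ∃₂ λ x ys → xs ↭ x ∷ ys × P x
  pick any = let x , x∈xs , px = find any ; ys , p = ∈⇒↭∷ x∈xs in x , ys , p , px

  sum-map-tabulate : ∀ {m} (f : A → ℕ) (g : Fin m → A) → sum (map f (tabulate g)) ≡ ∑ (λ i → f (g i))
  sum-map-tabulate {zero}  f g = refl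
  sum-map-tabulate {suc m} f g = cong (f (g zero) +_) (sum-map-tabulate f (λ i → g (suc i)))

  sum-map-≤ : ∀ (f : A → ℕ) c {xs} → All (λ x → f x ≤ c) xs → sum (map f xs) ≤ length xs * c
  sum-map-≤ f c []         = z≤n
  sum-map-≤ f c (fx≤ ∷ fs) = +-mono-≤ fx≤ (sum-map-≤ f c fs)

sucC2 : ∀ m → suc m C 2 ≡ m + m C 2
sucC2 m = trans (sym (nCk+nC[k+1]≡[n+1]C[k+1] m 1)) (cong (_+ m C 2) (nC1≡n m))

suc+suc : ∀ k → suc k + suc k ≡ 2 + (k + k)
suc+suc k = cong suc (+-suc k k)

indicator : Bool → ℕ
indicator b = if b then 1 else 0

missing : Bool → ℕ
missing true  = 0
missing false = 1

pairUp : ∀ {n} → Fin n → Fin n → (Fin n → Fin n) → Fin n → Fin n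
pairUp x y m z with z ≟ x
... | yes _ = y
... | no _ with z ≟ y
...   | yes _ = x
...   | no _  = m z

pairUp-x : ∀ {n} (x y : Fin n) m → pairUp x y m x ≡ y
pairUp-x x y m with x ≟ x
... | yes _   = refl
... | no x≢x  = ⊥-elim (x≢x refl)

pairUp-y : ∀ {n} (x y : Fin n) m → x ≢ y → pairUp x y m y ≡ x
pairUp-y x y m x≢y with y ≟ x
... | yes y≡x = ⊥-elim (x≢y (sym y≡x))
... | no _ with y ≟ y
...   | yes _   = refl
...   | no y≢y  = ⊥-elim (y≢y refl)

pairUp-other : ∀ {n} (x y : Fin n) m {z} → z ≢ x → z ≢ y → pairUp x y m z ≡ m z
pairUp-other x y m {z} z≢x z≢y with z ≟ x
... | yes z≡x = ⊥-elim (z≢x z≡x)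
... | no _ with z ≟ y
...   | yes z≡y = ⊥-elim (z≢y z≡y)
...   | no _    = refl

-- Non-edges inside a list of vertices

module NonEdges {n : ℕ} (G : Graph n) where

  -- x itself is counted when x ∈ ys, since adj G x x ≡ false.
  nonDegree : Fin n → List (Fin n) → ℕ
  nonDegree x []       = 0
  nonDegree x (y ∷ ys) = missing (adj G x y) + nonDegree x ys

  nonEdges : List (Fin n) → ℕ
  nonEdges []       = 0
  nonEdges (x ∷ xs) = nonDegree x xs + nonEdges xs

  Clique : List (Fin n) → Set
  Clique = AllPairs (λ x y → adj G x y ≡ true)

  missing-sym : ∀ x y → missing (adj G x y) ≡ missing (adj G y x)
  missing-sym x y = cong missing (adj-sym G x y)

  nonDegree-↭ : ∀ x {ys zs} → ys ↭ zs → nonDegree x ys ≡ nonDegree x zs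
  nonDegree-↭ x ↭.refl         = refl
  nonDegree-↭ x (prep y p)     = cong (missing (adj G x y) +_) (nonDegree-↭ x p)
  nonDegree-↭ x {y ∷ z ∷ _} {_ ∷ _ ∷ zs} (swap y z p) =
    trans (cong (λ t → missing (adj G x y) + (missing (adj G x z) + t)) (nonDegree-↭ x p))
          (x∙yz≈y∙xz (missing (adj G x y)) (missing (adj G x z)) (nonDegree x zs))
  nonDegree-↭ x (↭.trans p q)  = trans (nonDegree-↭ x p) (nonDegree-↭ x q)

  nonEdges-↭ : ∀ {xs ys} → xs ↭ ys → nonEdges xs ≡ nonEdges ys
  nonEdges-↭ ↭.refl        = refl
  nonEdges-↭ (prep x p)    = cong₂ _+_ (nonDegree-↭ x p) (nonEdges-↭ p)
  nonEdges-↭ {y ∷ z ∷ ys} {_ ∷ _ ∷ zs} (swap y z p) = begin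
    (missing (adj G y z) + nonDegree y ys) + (nonDegree z ys + nonEdges ys)
      ≡⟨ interchange (missing (adj G y z)) (nonDegree y ys) (nonDegree z ys) (nonEdges ys) ⟩
    (missing (adj G y z) + nonDegree z ys) + (nonDegree y ys + nonEdges ys)
      ≡⟨ cong₂ (λ m a → (m + a) + (nonDegree y ys + nonEdges ys)) (missing-sym y z) (nonDegree-↭ z p) ⟩
    (missing (adj G z y) + nonDegree z zs) + (nonDegree y ys + nonEdges ys)
      ≡⟨ cong₂ (λ a b → (missing (adj G z y) + nonDegree z zs) + (a + b)) (nonDegree-↭ y p) (nonEdges-↭ p) ⟩
    (missing (adj G z y) + nonDegree z zs) + (nonDegree y zs + nonEdges zs) ∎
    where open ≡-Reasoning
  nonEdges-↭ (↭.trans p q) = trans (nonEdges-↭ p) (nonEdges-↭ q)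

  nonDegree-self : ∀ x ys → nonDegree x (x ∷ ys) ≡ suc (nonDegree x ys)
  nonDegree-self x ys = cong (_+ nonDegree x ys) (cong missing (irrefl G x))

  nonDegree≤length : ∀ x ys → nonDegree x ys ≤ length ys
  nonDegree≤length x []       = z≤n
  nonDegree≤length x (y ∷ ys) with adj G x y
  ... | true  = m≤n⇒m≤1+n (nonDegree≤length x ys)
  ... | false = s≤s (nonDegree≤length x ys)

  nonDegree≤nonEdges : ∀ x ys → nonDegree x ys ≤ nonEdges (x ∷ ys)
  nonDegree≤nonEdges x ys = m≤m+n _ _

  nonDegree≡0⇒All : ∀ x ys → nonDegree x ys ≡ 0 → All (λ y → adj G x y ≡ true) ys
  nonDegree≡0⇒All x []       _ = []
  nonDegree≡0⇒All x (y ∷ ys) h with adj G x y in e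
  ... | true = e ∷ nonDegree≡0⇒All x ys h

  nonDegree≡length⇒All : ∀ x ys → nonDegree x ys ≡ length ys → All (λ y → adj G x y ≡ false) ys
  nonDegree≡length⇒All x []       _ = []
  nonDegree≡length⇒All x (y ∷ ys) h with adj G x y in e
  ... | false = e ∷ nonDegree≡length⇒All x ys (suc-injective h)
  ... | true  = ⊥-elim (1+n≰n (subst (_≤ length ys) h (nonDegree≤length x ys)))

  nonNeighbour⇒nonDegree>0 : ∀ {x y ys} → y ∈ ys → adj G x y ≡ false → 1 ≤ nonDegree x ys
  nonNeighbour⇒nonDegree>0 {x} {ys = z ∷ ys} (here refl) e rewrite e = s≤s z≤n
  nonNeighbour⇒nonDegree>0 {x} {ys = z ∷ ys} (there y∈) e =
    ≤-trans (nonNeighbour⇒nonDegree>0 y∈ e) (m≤n+m _ (missing (adj G x z)))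

  nonDegree>0⇒nonNeighbour : ∀ x ys → 1 ≤ nonDegree x ys → Any (λ y → adj G x y ≡ false) ys
  nonDegree>0⇒nonNeighbour x (y ∷ ys) h with adj G x y in e
  ... | false = here e
  ... | true  = there (nonDegree>0⇒nonNeighbour x ys h)

  nonDegree<length⇒neighbour : ∀ x ys → nonDegree x ys < length ys → Any (λ y → adj G x y ≡ true) ys
  nonDegree<length⇒neighbour x (y ∷ ys) h with adj G x y in e
  ... | true  = here e
  ... | false = there (nonDegree<length⇒neighbour x ys (≤-pred h))

  nonEdges>0⇒split : ∀ xs → 1 ≤ nonEdges xs → ∃₂ λ p ys → xs ↭ p ∷ ys × 1 ≤ nonDegree p ys
  nonEdges>0⇒split (x ∷ xs) h with nonDegree x xs in e
  ... | suc _ = x , xs , ↭-refl , subst (1 ≤_) (sym e) (s≤s z≤n)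
  ... | zero  with p , ys , xs↭ , h′ ← nonEdges>0⇒split xs h =
    p , x ∷ ys , ↭-trans (prep x xs↭) (swap x p ↭-refl) , ≤-trans h′ (m≤n+m _ (missing (adj G p x)))

  nonEdges≡0⇒Clique : ∀ xs → nonEdges xs ≡ 0 → Clique xs
  nonEdges≡0⇒Clique []       _ = []
  nonEdges≡0⇒Clique (x ∷ xs) h =
    nonDegree≡0⇒All x xs (m+n≡0⇒m≡0 _ h) ∷ nonEdges≡0⇒Clique xs (m+n≡0⇒n≡0 _ h)

  Clique-adj : ∀ {xs x y} → Clique xs → x ∈ xs → y ∈ xs → x ≢ y → adj G x y ≡ true
  Clique-adj (_  ∷ _) (here refl) (here refl) x≢y = ⊥-elim (x≢y refl)
  Clique-adj (xa ∷ _) (here refl) (there y∈)  _   = All.lookup xa y∈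
  Clique-adj (xa ∷ _) (there x∈)  (here refl) _   = trans (adj-sym G _ _) (All.lookup xa x∈)
  Clique-adj (_  ∷ c) (there x∈)  (there y∈)  x≢y = Clique-adj c x∈ y∈ x≢y

  degree : Fin n → List (Fin n) → ℕ
  degree x []       = 0
  degree x (y ∷ ys) = indicator (adj G x y) + degree x ys

  edges : List (Fin n) → ℕ
  edges []       = 0
  edges (x ∷ xs) = degree x xs + edges xs

  nonDegree+degree : ∀ x ys → nonDegree x ys + degree x ys ≡ length ys
  nonDegree+degree x []       = refl
  nonDegree+degree x (y ∷ ys) with adj G x y
  ... | true  = trans (+-suc (nonDegree x ys) _) (cong suc (nonDegree+degree x ys))
  ... | false = cong suc (nonDegree+degree x ys)

  nonEdges+edges : ∀ xs → nonEdges xs + edges xs ≡ length xs C 2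
  nonEdges+edges []       = refl
  nonEdges+edges (x ∷ xs) = begin
    (nonDegree x xs + nonEdges xs) + (degree x xs + edges xs)
      ≡⟨ interchange (nonDegree x xs) _ _ _ ⟩
    (nonDegree x xs + degree x xs) + (nonEdges xs + edges xs)
      ≡⟨ cong₂ _+_ (nonDegree+degree x xs) (nonEdges+edges xs) ⟩
    length xs + length xs C 2
      ≡⟨ sucC2 (length xs) ⟨
    suc (length xs) C 2 ∎
    where open ≡-Reasoning

  degree-tabulate : ∀ {m} x (g : Fin m → Fin n) → degree x (tabulate g) ≡ ∑ (λ j → indicator (adj G x (g j)))
  degree-tabulate {zero}  x g = refl
  degree-tabulate {suc m} x g = cong (indicator (adj G x (g zero)) +_) (degree-tabulate x (λ j → g (suc j)))

  -- toℕ i <ᵇ toℕ j unfolds definitionally when i or j is zero and under suc, so no case analysis is needed.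
  edges-tabulate : ∀ {m} (g : Fin m → Fin n) →
    edges (tabulate g) ≡ ∑ (λ i → ∑ (λ j → indicator ((toℕ i <ᵇ toℕ j) ∧ adj G (g i) (g j))))
  edges-tabulate {zero}  g = refl
  edges-tabulate {suc m} g = cong₂ _+_ (degree-tabulate (g zero) (λ j → g (suc j))) (edges-tabulate (λ i → g (suc i)))

  edgeCount≡edges : edgeCount G ≡ edges (allFin n)
  edgeCount≡edges = begin
    edgeCount G
      ≡⟨ sum-map-tabulate {m = n} _ (λ i → i) ⟩
    ∑ {n} (λ i → sum (map (λ j → indicator ((toℕ i <ᵇ toℕ j) ∧ adj G i j)) (allFin n)))
      ≡⟨ sum-cong-≗ {n} (λ i → sum-map-tabulate (λ j → indicator ((toℕ i <ᵇ toℕ j) ∧ adj G i j)) (λ j → j)) ⟩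
    ∑ {n} (λ i → ∑ {n} (λ j → indicator ((toℕ i <ᵇ toℕ j) ∧ adj G i j)))
      ≡⟨ edges-tabulate (λ i → i) ⟨
    edges (allFin n) ∎
    where open ≡-Reasoning

  edgeCount+nonEdges : edgeCount G + nonEdges (allFin n) ≡ n C 2
  edgeCount+nonEdges = begin
    edgeCount G + nonEdges (allFin n)    ≡⟨ cong (_+ nonEdges (allFin n)) edgeCount≡edges ⟩
    edges (allFin n) + nonEdges (allFin n) ≡⟨ +-comm (edges (allFin n)) _ ⟩
    nonEdges (allFin n) + edges (allFin n) ≡⟨ nonEdges+edges (allFin n) ⟩
    length (allFin n) C 2                ≡⟨ cong (_C 2) (length-tabulate {n = n} (λ i → i)) ⟩
    n C 2 ∎
    where open ≡-Reasoning

  nonDegreeSum : List (Fin n) → List (Fin n) → ℕ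
  nonDegreeSum xs ys = sum (map (λ x → nonDegree x ys) xs)

  nonDegreeSum-∷ʳ : ∀ xs y ys → nonDegreeSum xs (y ∷ ys) ≡ nonDegree y xs + nonDegreeSum xs ys
  nonDegreeSum-∷ʳ []       y ys = refl
  nonDegreeSum-∷ʳ (x ∷ xs) y ys = begin
    (missing (adj G x y) + nonDegree x ys) + nonDegreeSum xs (y ∷ ys)
      ≡⟨ cong (_ +_) (nonDegreeSum-∷ʳ xs y ys) ⟩
    (missing (adj G x y) + nonDegree x ys) + (nonDegree y xs + nonDegreeSum xs ys)
      ≡⟨ interchange (missing (adj G x y)) _ _ _ ⟩
    (missing (adj G x y) + nonDegree y xs) + (nonDegree x ys + nonDegreeSum xs ys)
      ≡⟨ cong (λ m → (m + nonDegree y xs) + _) (missing-sym x y) ⟩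
    (missing (adj G y x) + nonDegree y xs) + (nonDegree x ys + nonDegreeSum xs ys) ∎
    where open ≡-Reasoning

  handshake : ∀ xs → nonDegreeSum xs xs ≡ length xs + (nonEdges xs + nonEdges xs)
  handshake []       = refl
  handshake (x ∷ xs) = begin
    nonDegree x (x ∷ xs) + nonDegreeSum xs (x ∷ xs)
      ≡⟨ cong₂ _+_ (nonDegree-self x xs) (nonDegreeSum-∷ʳ xs x xs) ⟩
    suc (nonDegree x xs) + (nonDegree x xs + nonDegreeSum xs xs)
      ≡⟨ cong (λ t → suc (nonDegree x xs) + (nonDegree x xs + t)) (handshake xs) ⟩
    suc (nonDegree x xs) + (nonDegree x xs + (length xs + (nonEdges xs + nonEdges xs)))
      ≡⟨ rearrange (nonDegree x xs) (length xs) (nonEdges xs) ⟩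
    suc (length xs) + ((nonDegree x xs + nonEdges xs) + (nonDegree x xs + nonEdges xs)) ∎
    where
    open ≡-Reasoning
    rearrange : ∀ d l e → suc d + (d + (l + (e + e))) ≡ suc l + ((d + e) + (d + e))
    rearrange = solve-∀

  nonDegree≤2⇒nonEdges+nonEdges≤length : ∀ xs → All (λ x → nonDegree x xs ≤ 2) xs →
    nonEdges xs + nonEdges xs ≤ length xs
  nonDegree≤2⇒nonEdges+nonEdges≤length xs low = +-cancelˡ-≤ (length xs) _ _ (begin
    length xs + (nonEdges xs + nonEdges xs) ≡⟨ handshake xs ⟨
    nonDegreeSum xs xs                      ≤⟨ sum-map-≤ (λ x → nonDegree x xs) 2 low ⟩
    length xs * 2                           ≡⟨ *-comm (length xs) 2 ⟩
    length xs + (length xs + 0)             ≡⟨ cong (length xs +_) (+-identityʳ (length xs)) ⟩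
    length xs + length xs                   ∎)
    where open ≤-Reasoning

  nonEdges-split₂ : ∀ {xs x y zs} → xs ↭ x ∷ y ∷ zs → adj G x y ≡ true →
    nonEdges xs ≡ nonDegree x zs + (nonDegree y zs + nonEdges zs)
  nonEdges-split₂ {x = x} {y} {zs} p e =
    trans (nonEdges-↭ p) (cong (λ b → (missing b + nonDegree x zs) + (nonDegree y zs + nonEdges zs)) e)

  nonDegree-split-nonNeighbour : ∀ {x ys y zs} → ys ↭ y ∷ zs → adj G x y ≡ false →
    nonDegree x ys ≡ suc (nonDegree x zs)
  nonDegree-split-nonNeighbour {x} {zs = zs} p e =
    trans (nonDegree-↭ x p) (cong (λ b → missing b + nonDegree x zs) e)

  nonDegree-split-neighbour : ∀ {x ys y zs} → ys ↭ y ∷ zs → adj G x y ≡ true →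
    nonDegree x ys ≡ nonDegree x zs
  nonDegree-split-neighbour {x} {zs = zs} p e =
    trans (nonDegree-↭ x p) (cong (λ b → missing b + nonDegree x zs) e)

  -- Perfect matchings of dense vertex sets

  record MatchingOn (xs : List (Fin n)) : Set where
    field
      partner : Fin n → Fin n
      matched : ∀ {x} → x ∈ xs →
        partner x ∈ xs × adj G x (partner x) ≡ true × partner (partner x) ≡ x
  open MatchingOn

  MatchingOn-[] : MatchingOn []
  MatchingOn-[] = record { partner = λ x → x ; matched = λ () }

  MatchingOn-↭ : ∀ {xs ys} → xs ↭ ys → MatchingOn xs → MatchingOn ys
  MatchingOn-↭ p M = record
    { partner = partner M
    ; matched = λ x∈ → let m∈ , e , inv = matched M (∈-resp-↭ (↭-sym p) x∈) in ∈-resp-↭ p m∈ , e , inv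
    }

  MatchingOn-∷₂ : ∀ {x y xs} → Unique (x ∷ y ∷ xs) → adj G x y ≡ true →
    MatchingOn xs → MatchingOn (x ∷ y ∷ xs)
  MatchingOn-∷₂ {x} {y} {xs} d e M = record { partner = pairUp x y m ; matched = matched′ d }
    where
    m = partner M
    matched′ : Unique (x ∷ y ∷ xs) → ∀ {z} → z ∈ x ∷ y ∷ xs → pairUp x y m z ∈ x ∷ y ∷ xs ×
      adj G z (pairUp x y m z) ≡ true × pairUp x y m (pairUp x y m z) ≡ z
    matched′ ((x≢y ∷ _) ∷ _) (here refl) rewrite pairUp-x x y m | pairUp-y x y m x≢y =
      there (here refl) , e , refl
    matched′ ((x≢y ∷ _) ∷ _) (there (here refl)) rewrite pairUp-y x y m x≢y | pairUp-x x y m =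
      here refl , trans (adj-sym G y x) e , refl
    matched′ ((_ ∷ x≢xs) ∷ y≢xs ∷ _) {z} (there (there z∈)) with matched M z∈
    ... | m∈ , adj-m , inv
      rewrite pairUp-other x y m {z} (All.lookup x≢xs z∈ ∘ sym) (All.lookup y≢xs z∈ ∘ sym)
            | pairUp-other x y m {m z} (All.lookup x≢xs m∈ ∘ sym) (All.lookup y≢xs m∈ ∘ sym) =
      there (there m∈) , adj-m , inv

  toPerfectMatching : MatchingOn (allFin n) → PerfectMatching G
  toPerfectMatching M = record
    { mate     = partner M
    ; mate-adj = λ i → proj₁ (proj₂ (matched M (∈-allFin i)))
    ; mate-inv = λ i → proj₂ (proj₂ (matched M (∈-allFin i)))
    }

  record ReducingEdge (xs : List (Fin n)) (b : ℕ) : Set where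
    constructor reducingEdge
    field
      x y   : Fin n
      rest  : List (Fin n)
      split : xs ↭ x ∷ y ∷ rest
      edge  : adj G x y ≡ true
      bound : nonEdges rest ≤ b

  reducingEdge-by-cover : ∀ b {xs x y zs} → xs ↭ x ∷ y ∷ zs → adj G x y ≡ true →
    nonEdges xs ≤ b + (nonDegree x zs + nonDegree y zs) → ReducingEdge xs b
  reducingEdge-by-cover b {xs} {x} {y} {zs} p e h = reducingEdge x y zs p e (+-cancelˡ-≤ cover _ _ (begin
    cover + nonEdges zs                            ≡⟨ +-assoc (nonDegree x zs) _ _ ⟩
    nonDegree x zs + (nonDegree y zs + nonEdges zs) ≡⟨ nonEdges-split₂ p e ⟨
    nonEdges xs                                    ≤⟨ h ⟩
    b + cover                                      ≡⟨ +-comm b cover ⟩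
    cover + b                                      ∎))
    where
    open ≤-Reasoning
    cover = nonDegree x zs + nonDegree y zs

  reducingEdge-at : ∀ b {xs z ys} → xs ↭ z ∷ ys → nonDegree z ys < length ys →
    nonEdges xs ≤ b + nonDegree z ys → ReducingEdge xs b
  reducingEdge-at b {z = z} {ys} p lt h
    with y , zs , ys↭ , e ← pick (nonDegree<length⇒neighbour z ys lt) =
    reducingEdge-by-cover b (↭-trans p (prep z ys↭)) e (begin
      _                                   ≤⟨ h ⟩
      b + nonDegree z ys                  ≡⟨ cong (b +_) (nonDegree-split-neighbour ys↭ e) ⟩
      b + nonDegree z zs                  ≤⟨ +-monoʳ-≤ b (m≤m+n _ _) ⟩
      b + (nonDegree z zs + nonDegree y zs) ∎)
    where open ≤-Reasoning

  nonDegree-at-nonEdge≡0 : ∀ {xs p q zs} → All (λ z → nonDegree z xs ≤ 2) xs →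
    xs ↭ p ∷ q ∷ zs → adj G p q ≡ false → nonDegree p zs ≡ 0 × nonDegree q zs ≡ 0
  nonDegree-at-nonEdge≡0 {xs} {p} {q} {zs} low pq p≁q =
    n≤0⇒n≡0 (+-cancelˡ-≤ 2 _ 0 (subst (_≤ 2) p-xs (All.lookup low (∈-resp-↭ (↭-sym pq) (here refl))))) ,
    n≤0⇒n≡0 (+-cancelˡ-≤ 2 _ 0 (subst (_≤ 2) q-xs (All.lookup low (∈-resp-↭ (↭-sym pq) (there (here refl))))))
    where
    p-xs : nonDegree p xs ≡ 2 + nonDegree p zs
    p-xs = trans (nonDegree-↭ p pq) (cong₂ (λ a b → missing a + (missing b + nonDegree p zs)) (irrefl G p) p≁q)
    q-xs : nonDegree q xs ≡ 2 + nonDegree q zs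
    q-xs = trans (nonDegree-↭ q pq)
      (cong₂ (λ a b → missing a + (missing b + nonDegree q zs)) (trans (adj-sym G q p) p≁q) (irrefl G q))

  reducingEdge-lowNonDegree : ∀ b xs → All (λ z → nonDegree z xs ≤ 2) xs → 3 ≤ length xs →
    1 ≤ nonEdges xs → nonEdges xs ≤ b + 2 → ReducingEdge xs b
  reducingEdge-lowNonDegree b xs low len≥3 ne≥1 ne≤
    with p , ys , xs↭ , h ← nonEdges>0⇒split xs ne≥1
    with q , zs , ys↭ , p≁q ← pick (nonDegree>0⇒nonNeighbour p ys h) =
    fromNonEdge zs (↭-trans xs↭ (prep p ys↭)) p≁q
    where
    open ≤-Reasoning
    fromNonEdge : ∀ {p q} zs → xs ↭ p ∷ q ∷ zs → adj G p q ≡ false → ReducingEdge xs b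
    fromNonEdge [] pq _ = ⊥-elim (<⇒≱ len≥3 (≤-reflexive (↭-length pq)))
    fromNonEdge {p} {q} zs@(r ∷ ws) pq p≁q
      with only-q ← nonDegree-at-nonEdge≡0 low pq p≁q
      with nonEdges zs in ne-zs
    ... | zero = reducingEdge-by-cover b (↭-trans pq (prep p (swap q r ↭-refl))) (All.lookup p-zs (here refl))
      (begin
        nonEdges xs                                       ≡⟨ nonEdges-xs ⟩
        suc (nonEdges zs)                                 ≡⟨ cong suc ne-zs ⟩
        1                                                 ≤⟨ nonNeighbour⇒nonDegree>0 {ys = q ∷ ws} (here refl) p≁q ⟩
        nonDegree p (q ∷ ws)                              ≤⟨ m≤m+n _ _ ⟩
        nonDegree p (q ∷ ws) + nonDegree r (q ∷ ws)       ≤⟨ m≤n+m _ b ⟩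
        b + (nonDegree p (q ∷ ws) + nonDegree r (q ∷ ws)) ∎)
      where
      p-zs = nonDegree≡0⇒All p zs (proj₁ only-q)
      nonEdges-xs : nonEdges xs ≡ suc (nonEdges zs)
      nonEdges-xs rewrite nonEdges-↭ pq | p≁q | proj₁ only-q | proj₂ only-q = refl
    ... | suc _
      with r′ , ws′ , zs↭ , h′ ← nonEdges>0⇒split zs (subst (1 ≤_) (sym ne-zs) (s≤s z≤n))
      with s , vs , ws↭ , r≁s ← pick (nonDegree>0⇒nonNeighbour r′ ws′ h′) =
      reducingEdge-by-cover b
        (↭-trans pq (prep p (↭-trans (prep q (↭-trans zs↭ (prep r′ ws↭))) (swap q r′ ↭-refl))))
        (All.lookup (nonDegree≡0⇒All p zs (proj₁ only-q)) (∈-resp-↭ (↭-sym zs↭) (here refl)))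
        (≤-trans ne≤ (+-monoʳ-≤ b (+-mono-≤ (nonNeighbour⇒nonDegree>0 {ys = q ∷ s ∷ vs} (here refl) p≁q)
                                            (nonNeighbour⇒nonDegree>0 {ys = q ∷ s ∷ vs} (there (here refl)) r≁s))))

  reducingEdge-exists : ∀ k xs → length xs ≡ 4 + (k + k) → nonEdges xs ≤ 2 + (k + k) →
    ReducingEdge xs (k + k)
  reducingEdge-exists k xs@(x ∷ ys) len ne with nonEdges xs ≤? k + k
  ... | yes few = reducingEdge-at (k + k) ↭-refl (begin-strict
        nonDegree x ys  ≤⟨ nonDegree≤nonEdges x ys ⟩
        nonEdges xs     ≤⟨ few ⟩
        k + k           <⟨ m<n+m _ {3} (s≤s z≤n) ⟩
        3 + (k + k)     ≡⟨ suc-injective len ⟨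
        length ys       ∎)
        (≤-trans few (m≤m+n _ _))
    where open ≤-Reasoning
  ... | no many with any? (λ z → 3 ≤? nonDegree z xs) xs
  ...   | yes high with z , zs , p , h ← pick high = reducingEdge-at (k + k) p (begin-strict
          nonDegree z zs                ≤⟨ m≤m+n _ _ ⟩
          nonDegree z zs + nonEdges zs  ≡⟨ nonEdges-↭ p ⟨
          nonEdges xs                   ≤⟨ ne ⟩
          2 + (k + k)                   <⟨ n<1+n _ ⟩
          3 + (k + k)                   ≡⟨ suc-injective (trans (sym (↭-length p)) len) ⟨
          length zs                     ∎) (begin
          nonEdges xs                   ≤⟨ ne ⟩
          2 + (k + k)                   ≡⟨ +-comm 2 (k + k) ⟩
          (k + k) + 2                   ≤⟨ +-monoʳ-≤ (k + k) (≤-pred (subst (3 ≤_) nonDegree-z h)) ⟩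
          (k + k) + nonDegree z zs      ∎)
    where
    open ≤-Reasoning
    nonDegree-z : nonDegree z xs ≡ suc (nonDegree z zs)
    nonDegree-z = trans (nonDegree-↭ z p) (nonDegree-self z zs)
  ...   | no ¬high = reducingEdge-lowNonDegree (k + k) xs
          (All.map (λ ¬3≤ → ≤-pred (≰⇒> ¬3≤)) (¬Any⇒All¬ xs ¬high))
          (≤-trans (s≤s (s≤s (s≤s z≤n))) (≤-reflexive (sym len)))
          (≤-trans (s≤s z≤n) (≰⇒> many))
          (≤-trans ne (≤-reflexive (+-comm 2 (k + k))))

  matching-of-few-nonEdges : ∀ k xs → Unique xs → length xs ≡ 2 + (k + k) →
    nonEdges xs ≤ k + k → MatchingOn xs
  matching-of-reducingEdge : ∀ k {xs} → Unique xs → length xs ≡ 4 + (k + k) →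
    ReducingEdge xs (k + k) → MatchingOn xs

  matching-of-few-nonEdges zero (x ∷ y ∷ []) d _ ne with adj G x y in e
  ... | true  = MatchingOn-∷₂ d e MatchingOn-[]
  ... | false = contradiction (n≤0⇒n≡0 ne) λ ()
  matching-of-few-nonEdges (suc k) xs d len ne = matching-of-reducingEdge k d len′
    (reducingEdge-exists k xs len′ (subst (nonEdges xs ≤_) (suc+suc k) ne))
    where len′ = trans len (cong (2 +_) (suc+suc k))

  matching-of-reducingEdge k d len (reducingEdge x y rest p e bound) =
    MatchingOn-↭ (↭-sym p) (MatchingOn-∷₂ d′ e (matching-of-few-nonEdges k rest (AllPairs.tail (AllPairs.tail d′))
      (suc-injective (suc-injective (trans (sym (↭-length p)) len))) bound))
    where d′ = Unique-↭ p d

  Isolated : List (Fin n) → Set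
  Isolated xs = ∃₂ λ x ys → xs ↭ x ∷ ys × nonDegree x ys ≡ length ys

  IndependentTriple : List (Fin n) → Set
  IndependentTriple xs = ∃₂ λ x y → ∃₂ λ z ys → xs ↭ x ∷ y ∷ z ∷ ys ×
    adj G x y ≡ false × adj G x z ≡ false × adj G y z ≡ false

  nonEdges-independentTriple : ∀ {xs x y z T} → xs ↭ x ∷ y ∷ z ∷ T →
    adj G x y ≡ false → adj G x z ≡ false → adj G y z ≡ false →
    nonEdges xs ≡ 3 + (nonDegree x T + (nonDegree y T + (nonDegree z T + nonEdges T)))
  nonEdges-independentTriple {x = x} {y} {z} {T} p xy xz yz rewrite nonEdges-↭ p | xy | xz | yz =
    rearrange (nonDegree x T) (nonDegree y T) (nonDegree z T) (nonEdges T)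
    where
    rearrange : ∀ a b c e → suc (suc a) + (suc b + (c + e)) ≡ 3 + (a + (b + (c + e)))
    rearrange = solve-∀

  module Saturated (k : ℕ) {xs} (d : Unique xs) (len : length xs ≡ 4 + (k + k))
                   (ne : nonEdges xs ≡ 3 + (k + k)) where

    matching-by-cover : ∀ {x y zs} → xs ↭ x ∷ y ∷ zs → adj G x y ≡ true →
      3 ≤ nonDegree x zs + nonDegree y zs → MatchingOn xs
    matching-by-cover p e cover = matching-of-reducingEdge k d len (reducingEdge-by-cover (k + k) p e (begin
      nonEdges xs  ≡⟨ ne ⟩
      3 + (k + k)  ≡⟨ +-comm 3 (k + k) ⟩
      (k + k) + 3  ≤⟨ +-monoʳ-≤ (k + k) cover ⟩
      _            ∎))
      where open ≤-Reasoning

    matching-by-third-nonEdge : ∀ {z a b T q T′} → xs ↭ z ∷ a ∷ b ∷ T →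
      adj G z a ≡ false → adj G z b ≡ false → nonDegree z T ≡ 0 →
      T ↭ q ∷ T′ → 1 ≤ nonDegree q (a ∷ b ∷ T′) → MatchingOn xs
    matching-by-third-nonEdge {z} {a} {b} {T} {q} {T′} p za zb zT T↭ h =
      matching-by-cover (↭-trans p (prep z (↭-trans (prep a (↭-trans (prep b T↭) (swap b q ↭-refl))) (swap a q ↭-refl))))
        (All.lookup (nonDegree≡0⇒All z T zT) (∈-resp-↭ (↭-sym T↭) (here refl)))
        (+-mono-≤ {2} (subst (2 ≤_) (sym (cong₂ (λ u v → missing u + (missing v + nonDegree z T′)) za zb))
                             (s≤s (s≤s z≤n))) h)

    matching-or-triple : ∀ {z a b T} → xs ↭ z ∷ a ∷ b ∷ T →
      adj G z a ≡ false → adj G z b ≡ false → nonDegree z T ≡ 0 →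
      MatchingOn xs ⊎ (k ≡ 0 × IndependentTriple xs)
    matching-or-triple {z} {a} {b} {T} p za zb zT
      with nonDegree a T in ea | nonDegree b T in eb | nonEdges T in eT
    ... | suc _ | _ | _
      with q , T′ , T↭ , aq ← pick (nonDegree>0⇒nonNeighbour a T (subst (1 ≤_) (sym ea) (s≤s z≤n))) =
      inj₁ (matching-by-third-nonEdge p za zb zT T↭
              (nonNeighbour⇒nonDegree>0 {ys = a ∷ b ∷ T′} (here refl) (trans (adj-sym G q a) aq)))
    ... | zero | suc _ | _
      with q , T′ , T↭ , bq ← pick (nonDegree>0⇒nonNeighbour b T (subst (1 ≤_) (sym eb) (s≤s z≤n))) =
      inj₁ (matching-by-third-nonEdge p za zb zT T↭
              (nonNeighbour⇒nonDegree>0 {ys = a ∷ b ∷ T′} (there (here refl)) (trans (adj-sym G q b) bq)))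
    ... | zero | zero | suc _
      with q , T′ , T↭ , h ← nonEdges>0⇒split T (subst (1 ≤_) (sym eT) (s≤s z≤n)) =
      inj₁ (matching-by-third-nonEdge p za zb zT T↭
              (≤-trans h (≤-trans (m≤n+m _ _) (m≤n+m _ (missing (adj G q a))))))
    ... | zero | zero | zero with adj G a b in eab
    ...   | true  = contradiction (trans (sym ne) count) λ ()
      where
      count : nonEdges xs ≡ 2
      count rewrite nonEdges-↭ p | za | zb | zT | eab | ea | eb | eT = refl
    ...   | false = inj₂ (m+n≡0⇒m≡0 k (suc-injective (suc-injective (suc-injective (trans (sym ne) count)))) ,
                          z , a , b , T , p , za , zb , eab)
      where
      count : nonEdges xs ≡ 3
      count rewrite nonEdges-↭ p | za | zb | zT | eab | ea | eb | eT = refl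

    matching-or-obstruction-at : ∀ {z ys} → xs ↭ z ∷ ys → 2 ≤ nonDegree z ys →
      MatchingOn xs ⊎ Isolated xs ⊎ (k ≡ 0 × IndependentTriple xs)
    matching-or-obstruction-at {z} {ys} p two with length ys ≤? nonDegree z ys
    ... | yes iso = inj₂ (inj₁ (z , ys , p , ≤-antisym (nonDegree≤length z ys) iso))
    ... | no ¬iso with 3 ≤? nonDegree z ys
    ...   | yes three
      with y , zs , ys↭ , e ← pick (nonDegree<length⇒neighbour z ys (≰⇒> ¬iso)) =
      inj₁ (matching-by-cover (↭-trans p (prep z ys↭)) e
              (≤-trans (subst (3 ≤_) (nonDegree-split-neighbour ys↭ e) three) (m≤m+n _ _)))
    ...   | no ¬three
      with a , ys₁ , ys↭ , za ← pick (nonDegree>0⇒nonNeighbour z ys (≤-trans (s≤s z≤n) two))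
      with b , T , ys₁↭ , zb ← pick (nonDegree>0⇒nonNeighbour z ys₁ (≤-pred (≤-trans two (≤-reflexive (nonDegree-split-nonNeighbour ys↭ za)))))
      = Sum.map₂ inj₂ (matching-or-triple (↭-trans p (prep z (↭-trans ys↭ (prep a ys₁↭)))) za zb
          (suc-injective (suc-injective (trans (sym (trans nd-ys (cong suc (nonDegree-split-nonNeighbour ys₁↭ zb))))
            (≤-antisym (≤-pred (≰⇒> ¬three)) two)))))
      where
      nd-ys = nonDegree-split-nonNeighbour ys↭ za

    trichotomy : MatchingOn xs ⊎ Isolated xs ⊎ (k ≡ 0 × IndependentTriple xs)
    trichotomy with any? (λ z → 3 ≤? nonDegree z xs) xs
    ... | yes high with z , ys , p , h ← pick high = matching-or-obstruction-at p
          (≤-pred (subst (3 ≤_) (trans (nonDegree-↭ z p) (nonDegree-self z ys)) h))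
    ... | no ¬high = ⊥-elim (too-many-nonEdges (subst₂ (λ e l → e + e ≤ l) ne len
          (nonDegree≤2⇒nonEdges+nonEdges≤length xs (All.map (λ ¬3≤ → ≤-pred (≰⇒> ¬3≤)) (¬Any⇒All¬ xs ¬high)))))
      where
      too-many-nonEdges : ¬ ((3 + (k + k)) + (3 + (k + k)) ≤ 4 + (k + k))
      too-many-nonEdges h = 1+n≰n (≤-trans (n≤1+n _) (≤-pred (≤-trans (m≤n+m _ (k + k)) (≤-pred (≤-pred (≤-pred h))))))

  matching-or-obstruction : ∀ k xs → Unique xs → length xs ≡ 2 + (k + k) → nonEdges xs ≤ suc (k + k) →
    MatchingOn xs ⊎ Isolated xs ⊎ (k ≡ 1 × IndependentTriple xs)
  matching-or-obstruction zero (x ∷ y ∷ []) d _ _ with adj G x y in e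
  ... | true  = inj₁ (MatchingOn-∷₂ d e MatchingOn-[])
  ... | false = inj₂ (inj₁ (x , y ∷ [] , ↭-refl , cong (λ b → missing b + 0) e))
  matching-or-obstruction (suc k) xs d len ne with nonEdges xs ≤? suc k + suc k
  ... | yes few = inj₁ (matching-of-few-nonEdges (suc k) xs d len few)
  ... | no many = Sum.map₂ (Sum.map₂ (Product.map₁ (cong suc))) (Saturated.trichotomy k d
        (trans len (cong (2 +_) (suc+suc k)))
        (trans (≤-antisym ne (≰⇒> many)) (cong suc (suc+suc k))))

-- Graphs determined by the roles of a triple

-- Both exceptional graphs are determined by the positions of their vertices relative to a suitable
-- triple, so an isomorphism only has to match the triples.
data Role : Set where
  first second third other : Role

role : ∀ {n} → Fin n → Fin n → Fin n → Fin n → Role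
role x y z i with i ≟ x
... | yes _ = first
... | no _ with i ≟ y
...   | yes _ = second
...   | no _ with i ≟ z
...     | yes _ = third
...     | no _  = other

role-first : ∀ {n} (x y z : Fin n) → role x y z x ≡ first
role-first x y z with x ≟ x
... | yes _   = refl
... | no x≢x  = ⊥-elim (x≢x refl)

role-second : ∀ {n} {x y : Fin n} z → y ≢ x → role x y z y ≡ second
role-second {x = x} {y} z y≢x with y ≟ x
... | yes y≡x = ⊥-elim (y≢x y≡x)
... | no _ with y ≟ y
...   | yes _   = refl
...   | no y≢y  = ⊥-elim (y≢y refl)

role-third : ∀ {n} {x y z : Fin n} → z ≢ x → z ≢ y → role x y z z ≡ third
role-third {x = x} {y} {z} z≢x z≢y with z ≟ x
... | yes z≡x = ⊥-elim (z≢x z≡x)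
... | no _ with z ≟ y
...   | yes z≡y = ⊥-elim (z≢y z≡y)
...   | no _ with z ≟ z
...     | yes _   = refl
...     | no z≢z  = ⊥-elim (z≢z refl)

role-other : ∀ {n} {x y z i : Fin n} → i ≢ x → i ≢ y → i ≢ z → role x y z i ≡ other
role-other {x = x} {y} {z} {i} i≢x i≢y i≢z with i ≟ x
... | yes i≡x = ⊥-elim (i≢x i≡x)
... | no _ with i ≟ y
...   | yes i≡y = ⊥-elim (i≢y i≡y)
...   | no _ with i ≟ z
...     | yes i≡z = ⊥-elim (i≢z i≡z)
...     | no _    = refl

role-map : ∀ {n m} (f : Fin n → Fin m) → (∀ {a b} → f a ≡ f b → a ≡ b) →
  ∀ x y z i → role (f x) (f y) (f z) (f i) ≡ role x y z i
role-map f inj x y z i with i ≟ x | f i ≟ f x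
... | yes _    | yes _   = refl
... | yes refl | no ne   = ⊥-elim (ne refl)
... | no ne    | yes e   = ⊥-elim (ne (inj e))
... | no _     | no _ with i ≟ y | f i ≟ f y
...   | yes _    | yes _   = refl
...   | yes refl | no ne   = ⊥-elim (ne refl)
...   | no ne    | yes e   = ⊥-elim (ne (inj e))
...   | no _     | no _ with i ≟ z | f i ≟ f z
...     | yes _    | yes _   = refl
...     | yes refl | no ne   = ⊥-elim (ne refl)
...     | no ne    | yes e   = ⊥-elim (ne (inj e))
...     | no _     | no _    = refl

AdjacencyByRoles : ∀ {n} → Graph n → (Role → Role → Bool) → Fin n → Fin n → Fin n → Set
AdjacencyByRoles {n} G R x y z = ∀ i j → i ≢ j → adj G i j ≡ R (role x y z i) (role x y z j)

Distinct₃ : ∀ {n} → Fin n → Fin n → Fin n → Set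
Distinct₃ x y z = x ≢ y × x ≢ z × y ≢ z

⟨$⟩ʳ-injective : ∀ {n} (π : Permutation′ n) {a b} → π ⟨$⟩ʳ a ≡ π ⟨$⟩ʳ b → a ≡ b
⟨$⟩ʳ-injective π e = trans (sym (inverseˡ π)) (trans (cong (π ⟨$⟩ˡ_) e) (inverseˡ π))

transpose-≢ : ∀ {n} {i j k : Fin n} → k ≢ i → k ≢ j → PC.transpose i j k ≡ k
transpose-≢ {i = i} {j} {k} k≢i k≢j with k ≟ i
... | yes k≡i = ⊥-elim (k≢i k≡i)
... | no _ with k ≟ j
...   | yes k≡j = ⊥-elim (k≢j k≡j)
...   | no _    = refl

transpose-≡ : ∀ {n} (i j : Fin n) → PC.transpose i j i ≡ j
transpose-≡ i j with i ≟ i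
... | yes _   = refl
... | no i≢i  = ⊥-elim (i≢i refl)

redirect : ∀ {n} (π : Permutation′ n) (x x′ : Fin n) → Σ (Permutation′ n) λ σ →
  σ ⟨$⟩ʳ x ≡ x′ × (∀ {i} → π ⟨$⟩ʳ i ≢ π ⟨$⟩ʳ x → π ⟨$⟩ʳ i ≢ x′ → σ ⟨$⟩ʳ i ≡ π ⟨$⟩ʳ i)
redirect π x x′ = π ∘ₚ transpose (π ⟨$⟩ʳ x) x′ , transpose-≡ (π ⟨$⟩ʳ x) x′ , transpose-≢

permutation-of-triples : ∀ {n} {x y z x′ y′ z′ : Fin n} → Distinct₃ x y z → Distinct₃ x′ y′ z′ →
  Σ (Permutation′ n) λ π → π ⟨$⟩ʳ x ≡ x′ × π ⟨$⟩ʳ y ≡ y′ × π ⟨$⟩ʳ z ≡ z′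
permutation-of-triples {x = x} {y} {z} {x′} {y′} {z′} (x≢y , x≢z , y≢z) (x′≢y′ , x′≢z′ , y′≢z′)
  with σ₁ , σ₁x , _      ← redirect id x x′
  with σ₂ , σ₂y , σ₂-fix ← redirect σ₁ y y′
  with σ₃ , σ₃z , σ₃-fix ← redirect σ₂ z z′ = σ₃ , σ₃x , σ₃y , σ₃z
  where
  σ₂x : σ₂ ⟨$⟩ʳ x ≡ x′
  σ₂x = trans (σ₂-fix (x≢y ∘ ⟨$⟩ʳ-injective σ₁) (λ e → x′≢y′ (trans (sym σ₁x) e))) σ₁x
  σ₃x = trans (σ₃-fix (x≢z ∘ ⟨$⟩ʳ-injective σ₂) (λ e → x′≢z′ (trans (sym σ₂x) e))) σ₂x
  σ₃y = trans (σ₃-fix (y≢z ∘ ⟨$⟩ʳ-injective σ₂) (λ e → y′≢z′ (trans (sym σ₂y) e))) σ₂y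

Isomorphic-by-roles : ∀ {n} {G H : Graph n} (R : Role → Role → Bool) {x y z x′ y′ z′} →
  Distinct₃ x y z → Distinct₃ x′ y′ z′ →
  AdjacencyByRoles G R x y z → AdjacencyByRoles H R x′ y′ z′ → Isomorphic G H
Isomorphic-by-roles {G = G} {H} R {x} {y} {z} {x′} {y′} {z′} d d′ G-roles H-roles
  with π , πx , πy , πz ← permutation-of-triples d d′ = π , preserves
  where
  roles : ∀ i → role x′ y′ z′ (π ⟨$⟩ʳ i) ≡ role x y z i
  roles i rewrite sym πx | sym πy | sym πz = role-map (π ⟨$⟩ʳ_) (⟨$⟩ʳ-injective π) x y z i
  preserves : ∀ i j → adj H (π ⟨$⟩ʳ i) (π ⟨$⟩ʳ j) ≡ adj G i j
  preserves i j with i ≟ j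
  ... | yes refl = trans (irrefl H _) (sym (irrefl G i))
  ... | no i≢j = begin
    adj H (π ⟨$⟩ʳ i) (π ⟨$⟩ʳ j)                     ≡⟨ H-roles _ _ (i≢j ∘ ⟨$⟩ʳ-injective π) ⟩
    R (role x′ y′ z′ (π ⟨$⟩ʳ i)) (role x′ y′ z′ (π ⟨$⟩ʳ j)) ≡⟨ cong₂ R (roles i) (roles j) ⟩
    R (role x y z i) (role x y z j)                 ≡⟨ G-roles i j i≢j ⟨
    adj G i j                                       ∎
    where open ≡-Reasoning

module _ {n} {G : Graph n} (R : Role → Role → Bool) (R-sym : ∀ a b → R a b ≡ R b a)
         (R-other : R other other ≡ true) where

  AdjacencyByRoles-of-split : ∀ {x y z W} → allFin n ↭ x ∷ y ∷ z ∷ W →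
    adj G x y ≡ R first second → adj G x z ≡ R first third → adj G y z ≡ R second third →
    All (λ w → adj G x w ≡ R first other) W → All (λ w → adj G y w ≡ R second other) W →
    All (λ w → adj G z w ≡ R third other) W → NonEdges.Clique G W →
    Distinct₃ x y z × AdjacencyByRoles G R x y z
  AdjacencyByRoles-of-split {x} {y} {z} {W} split xy xz yz xW yW zW clique
    with (x≢y ∷ x≢z ∷ x≢W) ∷ (y≢z ∷ y≢W) ∷ (z≢W ∷ _) ← Unique-↭ split (allFin⁺ n) =
    (x≢y , x≢z , y≢z) , λ i j i≢j →
      let i∈ = ∈-resp-↭ split (∈-allFin i) ; j∈ = ∈-resp-↭ split (∈-allFin j)
      in trans (byRole i∈ j∈ i≢j) (cong₂ R (sym (role-at i∈)) (sym (role-at j∈)))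
    where
    roleAt : ∀ {i} → i ∈ x ∷ y ∷ z ∷ W → Role
    roleAt (here _)                  = first
    roleAt (there (here _))          = second
    roleAt (there (there (here _)))  = third
    roleAt (there (there (there _))) = other

    role-at : ∀ {i} (i∈ : i ∈ x ∷ y ∷ z ∷ W) → role x y z i ≡ roleAt i∈
    role-at (here refl)                  = role-first x y z
    role-at (there (here refl))          = role-second z (x≢y ∘ sym)
    role-at (there (there (here refl)))  = role-third (x≢z ∘ sym) (y≢z ∘ sym)
    role-at (there (there (there w∈)))   =
      role-other (All.lookup x≢W w∈ ∘ sym) (All.lookup y≢W w∈ ∘ sym) (All.lookup z≢W w∈ ∘ sym)

    flipped : ∀ {a b r s} → adj G a b ≡ R r s → adj G b a ≡ R s r
    flipped {a} {b} {r} {s} e = trans (adj-sym G b a) (trans e (R-sym r s))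

    byRole : ∀ {i j} (i∈ : i ∈ x ∷ y ∷ z ∷ W) (j∈ : j ∈ x ∷ y ∷ z ∷ W) → i ≢ j →
      adj G i j ≡ R (roleAt i∈) (roleAt j∈)
    byRole (here refl)                 (here refl)                 i≢j = ⊥-elim (i≢j refl)
    byRole (here refl)                 (there (here refl))         _   = xy
    byRole (here refl)                 (there (there (here refl))) _   = xz
    byRole (here refl)                 (there (there (there w∈)))  _   = All.lookup xW w∈
    byRole (there (here refl))         (here refl)                 _   = flipped xy
    byRole (there (here refl))         (there (here refl))         i≢j = ⊥-elim (i≢j refl)
    byRole (there (here refl))         (there (there (here refl))) _   = yz
    byRole (there (here refl))         (there (there (there w∈)))  _   = All.lookup yW w∈
    byRole (there (there (here refl))) (here refl)                 _   = flipped xz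
    byRole (there (there (here refl))) (there (here refl))         _   = flipped yz
    byRole (there (there (here refl))) (there (there (here refl))) i≢j = ⊥-elim (i≢j refl)
    byRole (there (there (here refl))) (there (there (there w∈)))  _   = All.lookup zW w∈
    byRole (there (there (there w∈)))  (here refl)                 _   = flipped (All.lookup xW w∈)
    byRole (there (there (there w∈)))  (there (here refl))         _   = flipped (All.lookup yW w∈)
    byRole (there (there (there w∈)))  (there (there (here refl))) _   = flipped (All.lookup zW w∈)
    byRole (there (there (there w∈)))  (there (there (there v∈)))  i≢j =
      trans (NonEdges.Clique-adj G clique w∈ v∈ i≢j) (sym R-other)

isFirst isOther : Role → Bool
isFirst first = true
isFirst _     = false
isOther other = true
isOther _     = false

-- x is the K₁, y and z form the K₂, and the other vertices form the K_m.
roles-K2∨[Km∪K1] : Role → Role → Bool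
roles-K2∨[Km∪K1] a b = not (isFirst a ∧ isOther b) ∧ not (isFirst b ∧ isOther a)

-- x, y and z are the three independent vertices.
roles-K3∨3K1 : Role → Role → Bool
roles-K3∨3K1 a b = not (not (isOther a) ∧ not (isOther b)) ∧ not (not (isOther b) ∧ not (isOther a))

roles-K2∨[Km∪K1]-sym : ∀ a b → roles-K2∨[Km∪K1] a b ≡ roles-K2∨[Km∪K1] b a
roles-K2∨[Km∪K1]-sym a b = ∧-comm (not (isFirst a ∧ isOther b)) _

roles-K3∨3K1-sym : ∀ a b → roles-K3∨3K1 a b ≡ roles-K3∨3K1 b a
roles-K3∨3K1-sym a b = ∧-comm (not (not (isOther a) ∧ not (isOther b))) _

mkGraph-adj : ∀ {k} (r : Fin k → Fin k → Bool) {i j} → i ≢ j → adj (mkGraph r) i j ≡ r i j ∧ r j i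
mkGraph-adj r {i} {j} i≢j with i ≟ j
... | yes i≡j = ⊥-elim (i≢j i≡j)
... | no _    = refl

K2∨[Km∪K1]-byRoles : ∀ m → AdjacencyByRoles (K2∨[Km∪K1] m) roles-K2∨[Km∪K1] zero (suc zero) (suc (suc zero))
K2∨[Km∪K1]-byRoles m i j i≢j = trans (mkGraph-adj (λ i j → not ((toℕ i <ᵇ 1) ∧ (2 <ᵇ toℕ j))) i≢j)
  (cong₂ (λ p q → not p ∧ not q) (cong₂ _∧_ (in-K1 i) (in-Km j)) (cong₂ _∧_ (in-K1 j) (in-Km i)))
  where
  in-K1 : ∀ (i : Fin (3 + m)) → (toℕ i <ᵇ 1) ≡ isFirst (role zero (suc zero) (suc (suc zero)) i)
  in-K1 zero                = refl
  in-K1 (suc zero)          = refl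
  in-K1 (suc (suc zero))    = refl
  in-K1 (suc (suc (suc _))) = refl
  in-Km : ∀ (i : Fin (3 + m)) → (2 <ᵇ toℕ i) ≡ isOther (role zero (suc zero) (suc (suc zero)) i)
  in-Km zero                = refl
  in-Km (suc zero)          = refl
  in-Km (suc (suc zero))    = refl
  in-Km (suc (suc (suc _))) = refl

K3∨3K1-byRoles : AdjacencyByRoles K3∨3K1 roles-K3∨3K1 (suc (suc (suc zero))) (suc (suc (suc (suc zero))))
                                                   (suc (suc (suc (suc (suc zero)))))
K3∨3K1-byRoles i j i≢j = trans (mkGraph-adj (λ i j → not ((2 <ᵇ toℕ i) ∧ (2 <ᵇ toℕ j))) i≢j)
  (cong₂ (λ p q → not p ∧ not q) (cong₂ _∧_ (independent i) (independent j)) (cong₂ _∧_ (independent j) (independent i)))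
  where
  independent : ∀ (i : Fin 6) → (2 <ᵇ toℕ i) ≡
    not (isOther (role (suc (suc (suc zero))) (suc (suc (suc (suc zero)))) (suc (suc (suc (suc (suc zero))))) i))
  independent zero                                   = refl
  independent (suc zero)                             = refl
  independent (suc (suc zero))                       = refl
  independent (suc (suc (suc zero)))                 = refl
  independent (suc (suc (suc (suc zero))))           = refl
  independent (suc (suc (suc (suc (suc zero)))))     = refl

≅K2∨[Km∪K1] : ∀ {m} {G : Graph (3 + m)} {x y z} → Distinct₃ x y z →
  AdjacencyByRoles G roles-K2∨[Km∪K1] x y z → Isomorphic G (K2∨[Km∪K1] m)
≅K2∨[Km∪K1] {m} {G} d byRoles =
  Isomorphic-by-roles {G = G} {K2∨[Km∪K1] m} roles-K2∨[Km∪K1] d ((λ ()) , (λ ()) , (λ ()))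
    byRoles (K2∨[Km∪K1]-byRoles m)

≅K3∨3K1 : ∀ {G : Graph 6} {x y z} → Distinct₃ x y z → AdjacencyByRoles G roles-K3∨3K1 x y z → Isomorphic G K3∨3K1
≅K3∨3K1 {G} d byRoles =
  Isomorphic-by-roles {G = G} {K3∨3K1} roles-K3∨3K1 d ((λ ()) , (λ ()) , (λ ())) byRoles K3∨3K1-byRoles

-- Extending an edge

allFin-split₂ : ∀ {n} {u v : Fin n} → u ≢ v → ∃ λ S → allFin n ↭ u ∷ v ∷ S
allFin-split₂ {u = u} {v} u≢v with R , U↭ ← ∈⇒↭∷ (∈-allFin u) with ∈-resp-↭ U↭ (∈-allFin v)
... | here v≡u = ⊥-elim (u≢v (sym v≡u))
... | there v∈ with S , R↭ ← ∈⇒↭∷ v∈ = S , ↭-trans U↭ (prep u R↭)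

budget-exhausted : ∀ a b m c → a + (b + (m + c)) ≤ m → a ≡ 0 × b ≡ 0 × c ≡ 0
budget-exhausted a b m c h = m+n≡0⇒m≡0 a abc , m+n≡0⇒m≡0 b (m+n≡0⇒n≡0 a abc) , m+n≡0⇒n≡0 b (m+n≡0⇒n≡0 a abc)
  where
  rearrange : ∀ a b m c → a + (b + (m + c)) ≡ m + (a + (b + c))
  rearrange = solve-∀
  abc : a + (b + c) ≡ 0
  abc = n≤0⇒n≡0 (+-cancelˡ-≤ m _ 0 (subst₂ _≤_ (rearrange a b m c) (sym (+-identityʳ m)) h))

module AfterEdgeRemoval {n} (G : Graph n) {u v S} (split : allFin n ↭ u ∷ v ∷ S) (uv : adj G u v ≡ true)
  (u-full : NonEdges.nonDegree G u S ≡ 0) (v-full : NonEdges.nonDegree G v S ≡ 0) where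
  open NonEdges G

  isolated-roles : ∀ {x T} → S ↭ x ∷ T → All (λ w → adj G x w ≡ false) T → nonEdges T ≡ 0 →
    Distinct₃ x u v × AdjacencyByRoles G roles-K2∨[Km∪K1] x u v
  isolated-roles {x} {T} S↭ xT T0 =
    AdjacencyByRoles-of-split {G = G} roles-K2∨[Km∪K1] roles-K2∨[Km∪K1]-sym refl
      (↭-trans split (↭-trans (prep u (prep v S↭)) (shifts (u ∷ v ∷ []) (x ∷ []))))
      (trans (adj-sym G x u) (All.head uxT)) (trans (adj-sym G x v) (All.head vxT)) uv
      xT (All.tail uxT) (All.tail vxT) (nonEdges≡0⇒Clique T T0)
    where
    uxT = All-resp-↭ S↭ (nonDegree≡0⇒All u S u-full)
    vxT = All-resp-↭ S↭ (nonDegree≡0⇒All v S v-full)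

  triple-roles : ∀ {x y z T} → S ↭ x ∷ y ∷ z ∷ T →
    adj G x y ≡ false → adj G x z ≡ false → adj G y z ≡ false →
    nonDegree x T ≡ 0 → nonDegree y T ≡ 0 → nonDegree z T ≡ 0 → nonEdges T ≡ 0 →
    Distinct₃ x y z × AdjacencyByRoles G roles-K3∨3K1 x y z
  triple-roles {x} {y} {z} {T} S↭ xy xz yz xT yT zT T0 =
    AdjacencyByRoles-of-split {G = G} roles-K3∨3K1 roles-K3∨3K1-sym refl
      (↭-trans split (↭-trans (prep u (prep v S↭)) (shifts (u ∷ v ∷ []) (x ∷ y ∷ z ∷ []))))
      xy xz yz (toW (here refl) xT) (toW (there (here refl)) yT) (toW (there (there (here refl))) zT)
      ((uv ∷ All.tail (All.tail (All.tail uS))) ∷ All.tail (All.tail (All.tail vS)) ∷ nonEdges≡0⇒Clique T T0)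
    where
    uS = All-resp-↭ S↭ (nonDegree≡0⇒All u S u-full)
    vS = All-resp-↭ S↭ (nonDegree≡0⇒All v S v-full)
    toW : ∀ {w} → w ∈ x ∷ y ∷ z ∷ T → nonDegree w T ≡ 0 → All (λ t → adj G w t ≡ true) (u ∷ v ∷ T)
    toW w∈ wT = trans (adj-sym G _ u) (All.lookup uS w∈) ∷ trans (adj-sym G _ v) (All.lookup vS w∈) ∷
                  nonDegree≡0⇒All _ T wT

module EdgeExtension (k : ℕ) (G : Graph (4 + (k + k))) {u v S} (split : allFin (4 + (k + k)) ↭ u ∷ v ∷ S)
         (uv : adj G u v ≡ true) (sparse : NonEdges.nonEdges G (allFin (4 + (k + k))) ≤ suc (k + k)) where
  open NonEdges G

  budget : nonDegree u S + (nonDegree v S + nonEdges S) ≤ suc (k + k)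
  budget = subst (_≤ suc (k + k)) (nonEdges-split₂ split uv) sparse

  unique : Unique (u ∷ v ∷ S)
  unique = Unique-↭ split (allFin⁺ _)

  length-S : length S ≡ 2 + (k + k)
  length-S = suc-injective (suc-injective (trans (sym (↭-length split)) (length-tabulate (λ i → i))))

  isolated⇒K2∨[Km∪K1] : Isolated S → Isomorphic G (K2∨[Km∪K1] (suc (k + k)))
  isolated⇒K2∨[Km∪K1] (x , T , S↭ , iso) =
    let u0 , v0 , T0 = budget-exhausted (nonDegree u S) (nonDegree v S) (suc (k + k)) (nonEdges T)
                         (subst (λ e → nonDegree u S + (nonDegree v S + e) ≤ suc (k + k)) nonEdges-S budget)
    in Product.uncurry (≅K2∨[Km∪K1] {G = G})
         (AfterEdgeRemoval.isolated-roles G split uv u0 v0 S↭ (nonDegree≡length⇒All x T iso) T0)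
    where
    nonEdges-S : nonEdges S ≡ suc (k + k) + nonEdges T
    nonEdges-S = trans (nonEdges-↭ S↭) (cong (_+ nonEdges T)
      (trans iso (suc-injective (trans (sym (↭-length S↭)) length-S))))

  independentTriple⇒roles : k ≡ 1 → IndependentTriple S →
    ∃₂ λ x y → ∃ λ z → Distinct₃ x y z × AdjacencyByRoles G roles-K3∨3K1 x y z
  independentTriple⇒roles refl (x , y , z , T , S↭ , xy , xz , yz) =
    let u0 , v0 , rest0 = budget-exhausted (nonDegree u S) (nonDegree v S) 3 (dx + (dy + (dz + nonEdges T)))
                            (subst (λ e → nonDegree u S + (nonDegree v S + e) ≤ 3)
                                   (nonEdges-independentTriple S↭ xy xz yz) budget)
        x0 = m+n≡0⇒m≡0 dx rest0
        y0 = m+n≡0⇒m≡0 dy (m+n≡0⇒n≡0 dx rest0)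
        z0 = m+n≡0⇒m≡0 dz (m+n≡0⇒n≡0 dy (m+n≡0⇒n≡0 dx rest0))
        T0 = m+n≡0⇒n≡0 dz (m+n≡0⇒n≡0 dy (m+n≡0⇒n≡0 dx rest0))
    in x , y , z , AfterEdgeRemoval.triple-roles G split uv u0 v0 S↭ xy xz yz x0 y0 z0 T0
    where
    dx = nonDegree x T
    dy = nonDegree y T
    dz = nonDegree z T

  matching-or-exceptional :
    (Σ (PerfectMatching G) λ M → mate M u ≡ v) ⊎ Isomorphic G (K2∨[Km∪K1] (suc (k + k))) ⊎
    (k ≡ 1 × ∃₂ λ x y → ∃ λ z → Distinct₃ x y z × AdjacencyByRoles G roles-K3∨3K1 x y z)
  matching-or-exceptional with matching-or-obstruction k S (AllPairs.tail (AllPairs.tail unique)) length-S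
                                 (≤-trans (m≤n+m _ (nonDegree v S)) (≤-trans (m≤n+m _ (nonDegree u S)) budget))
  ... | inj₁ M = inj₁ (toPerfectMatching (MatchingOn-↭ (↭-sym split) (MatchingOn-∷₂ unique uv M)) ,
                       pairUp-x u v (MatchingOn.partner M))
  ... | inj₂ (inj₁ isolated)          = inj₂ (inj₁ (isolated⇒K2∨[Km∪K1] isolated))
  ... | inj₂ (inj₂ (k≡1 , triple))    = inj₂ (inj₂ (k≡1 , independentTriple⇒roles k≡1 triple))

extendable-or-exceptional : ∀ k (G : Graph (4 + (k + k))) →
  NonEdges.nonEdges G (allFin (4 + (k + k))) ≤ suc (k + k) → ∀ {u v} → adj G u v ≡ true →
  (Σ (PerfectMatching G) λ M → mate M u ≡ v) ⊎ Isomorphic G (K2∨[Km∪K1] (suc (k + k))) ⊎ Isomorphic G K3∨3K1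
extendable-or-exceptional k G sparse {u} uv
  with S , split ← allFin-split₂ (λ { refl → contradiction (trans (sym uv) (irrefl G u)) λ () })
  with EdgeExtension.matching-or-exceptional k G split uv sparse
... | inj₁ M                                   = inj₁ M
... | inj₂ (inj₁ iso)                          = inj₂ (inj₁ iso)
... | inj₂ (inj₂ (refl , x , y , z , d , byRoles)) = inj₂ (inj₂ (≅K3∨3K1 {G = G} d byRoles))

edgeCount≤ : ∀ {n} (G : Graph n) → edgeCount G ≤ n C 2
edgeCount≤ G = ≤-trans (m≤m+n _ _) (≤-reflexive (NonEdges.edgeCount+nonEdges G))

nonEdges≤ : ∀ {m} (G : Graph (3 + m)) → edgeCount G ≥ (2 + m) C 2 + 2 →
  NonEdges.nonEdges G (allFin (3 + m)) ≤ m
nonEdges≤ {m} G dense = ≤-pred (≤-pred (+-cancelʳ-≤ ((2 + m) C 2) _ _ (begin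
  (2 + nonEdges) + (2 + m) C 2         ≡⟨ rearrange nonEdges ((2 + m) C 2) ⟩
  nonEdges + ((2 + m) C 2 + 2)         ≤⟨ +-monoʳ-≤ nonEdges dense ⟩
  nonEdges + edgeCount G               ≡⟨ +-comm nonEdges _ ⟩
  edgeCount G + nonEdges               ≡⟨ NonEdges.edgeCount+nonEdges G ⟩
  (3 + m) C 2                          ≡⟨ sucC2 (2 + m) ⟩
  (2 + m) + (2 + m) C 2                ∎)))
  where
  open ≤-Reasoning
  nonEdges = NonEdges.nonEdges G (allFin (3 + m))
  rearrange : ∀ e c → (2 + e) + c ≡ e + (c + 2)
  rearrange = solve-∀

connected⇒edge : ∀ {n} (G : Graph (2 + n)) → Connected G → ∃ λ w → adj G zero w ≡ true
connected⇒edge G connected with connected zero (suc zero)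
... | step e _ = _ , e

even⇒odd-predecessor : ∀ m k → 3 + m ≡ 2 * k → ∃ λ j → m ≡ suc (j + j)
even⇒odd-predecessor m (suc (suc j)) e =
  j , suc-injective (suc-injective (suc-injective (trans e (double j))))
  where
  double : ∀ j → 2 * suc (suc j) ≡ 4 + (j + j)
  double = solve-∀

corollary1p2 : (n : ℕ) → 0 < n → (∃ λ k → n ≡ 2 * k) →
    (G : Graph n) → Connected G → edgeCount G ≥ ((n ∸ 1) C 2) + 2 →
    ¬ Isomorphic G (K2∨[Km∪K1] (n ∸ 3)) → ¬ Isomorphic G K3∨3K1 →
    OneExtendable G
corollary1p2 1 _ (suc k , 1≡2k) = ⊥-elim (m+1+n≢0 k (sym (suc-injective 1≡2k)))
corollary1p2 2 _ _ G _ dense = ⊥-elim (1+n≰n (≤-trans dense (edgeCount≤ G)))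
corollary1p2 (suc (suc (suc m))) _ (k , even) G connected dense ¬K2∨[Km∪K1] ¬K3∨3K1
  with j , refl ← even⇒odd-predecessor m k even =
  s≤s (s≤s (s≤s (s≤s z≤n))) , proj₁ (extend (proj₂ (connected⇒edge G connected))) , λ _ _ → extend
  where
  extend : ∀ {u v} → adj G u v ≡ true → Σ (PerfectMatching G) λ M → mate M u ≡ v
  extend uv = [ (λ M → M) , [ ⊥-elim ∘ ¬K2∨[Km∪K1] , ⊥-elim ∘ ¬K3∨3K1 ] ]
                (extendable-or-exceptional j G (nonEdges≤ G dense) uv)
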